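{- Let $n\geq2$ and let $K_{1,n-1}$ be the star of order $n$. Then $DOM^+_{maj}(K_{1,n-1})=0$ if $n$ is even and $DOM^+_{maj}(K_{1,n-1})=1$ if $n$ is odd. Moreover, if $n\geq5$, then $dom^+_{maj}(K_{1,n-1})=-2$ if $n$ is even and $dom^+_{maj}(K_{1,n-1})=-1$ if $n$ is odd.
   Context: Digraphs are finite, without loops or multiple arcs. For a digraph $D=(V,A)$ and $u\in V$, $N^+[u]=\{u\}\cup\{v: uv\in A\}$; for $f:V\to\{ -1,1\}$ and $X\subseteq V$, $f(X)=\sum_{v\in X}f(v)$. A majority out-dominating function (MODF) of $D$ is $f:V\to\{ -1,1\}$ with $|\{v: f(N^+[v])\geq1\}|\geq|V|/2$; its weight is $f(V)$; $\gamma^+_{maj}(D)$ is the minimum weight of a MODF. An orientation of a graph $G=(V,E)$ is a digraph $(V,A)$ obtained by replacing each edge $uv$ by exactly one of the arcs $uv$, $vu$. $dom^+_{maj}(G)$ and $DOM^+_{maj}(G)$ are the minimum and maximum of $\gamma^+_{maj}(D)$ over all orientations $D$ of $G$. -}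

module Defs where

open import Data.Nat using (ℕ; zero; suc)
open import Data.Nat as ℕ using ()
open import Data.Integer using (ℤ; +_; _+_; _≤_; -_)
open import Data.Fin using (Fin; zero; suc)
open import Data.Bool using (Bool; true; false; _∨_; _∧_; _xor_; not; if_then_else_)
open import Data.Product using (Σ; _×_; ∃)
open import Relation.Binary.PropositionalEquality using (_≡_)

sumFin : {n : ℕ} → (Fin n → ℤ) → ℤ
sumFin {zero}  g = + 0
sumFin {suc n} g = g zero + sumFin (λ i → g (suc i))

countFin : {n : ℕ} → (Fin n → Bool) → ℕ
countFin {zero}  p = 0
countFin {suc n} p = (if p zero then 1 else 0) ℕ.+ countFin (λ i → p (suc i))

record Graph (n : ℕ) : Set where
  field
    adj   : Fin n → Fin n → Bool
    sym   : ∀ u v → adj u v ≡ adj v u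
    irrefl : ∀ u → adj u u ≡ false
open Graph public

Digraph : ℕ → Set
Digraph n = Fin n → Fin n → Bool

IsOrientation : {n : ℕ} → Graph n → Digraph n → Set
IsOrientation {n} G D =
  ∀ (u v : Fin n) → (D u v ∨ D v u ≡ adj G u v) × (D u v ∧ D v u ≡ false)

-- Functions V → {-1,1}: true ↦ 1, false ↦ -1.
SignFun : ℕ → Set
SignFun n = Fin n → Bool

val : Bool → ℤ
val true  = + 1
val false = - (+ 1)

weight : {n : ℕ} → SignFun n → ℤ
weight f = sumFin (λ v → val (f v))

closedOutSum : {n : ℕ} → Digraph n → SignFun n → Fin n → ℤ
closedOutSum D f v = val (f v) + sumFin (λ u → if D v u then val (f u) else + 0)

goodVertex : {n : ℕ} → Digraph n → SignFun n → Fin n → Bool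
goodVertex D f v = Data.Integer._≤ᵇ_ (+ 1) (closedOutSum D f v)
  where import Data.Integer

-- MODF: |{v : f(N⁺[v]) ≥ 1}| ≥ |V|/2, i.e. 2·|{…}| ≥ n.
IsMODF : {n : ℕ} → Digraph n → SignFun n → Set
IsMODF {n} D f = n ℕ.≤ 2 ℕ.* countFin (goodVertex D f)

IsGammaMaj : {n : ℕ} → Digraph n → ℤ → Set
IsGammaMaj {n} D w =
  (Σ (SignFun n) λ f → IsMODF D f × weight f ≡ w) ×
  (∀ (f : SignFun n) → IsMODF D f → w ≤ weight f)

IsMinDomMaj : {n : ℕ} → Graph n → ℤ → Set
IsMinDomMaj {n} G w =
  (Σ (Digraph n) λ D → IsOrientation G D × IsGammaMaj D w) ×
  (∀ (D : Digraph n) (w' : ℤ) → IsOrientation G D → IsGammaMaj D w' → w ≤ w')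

IsMaxDomMaj : {n : ℕ} → Graph n → ℤ → Set
IsMaxDomMaj {n} G w =
  (Σ (Digraph n) λ D → IsOrientation G D × IsGammaMaj D w) ×
  (∀ (D : Digraph n) (w' : ℤ) → IsOrientation G D → IsGammaMaj D w' → w' ≤ w)

-- The star K_{1,n-1} on Fin n, with centre zero.
isZero : {n : ℕ} → Fin n → Bool
isZero zero    = true
isZero (suc _) = false

private
  xor-comm : ∀ a b → a xor b ≡ b xor a
  xor-comm true  true  = Relation.Binary.PropositionalEquality.refl
  xor-comm true  false = Relation.Binary.PropositionalEquality.refl
  xor-comm false true  = Relation.Binary.PropositionalEquality.refl
  xor-comm false false = Relation.Binary.PropositionalEquality.refl
    where import Relation.Binary.PropositionalEquality
  xor-self : ∀ a → a xor a ≡ false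
  xor-self true  = Relation.Binary.PropositionalEquality.refl
  xor-self false = Relation.Binary.PropositionalEquality.refl

star : (n : ℕ) → Graph n
star n = record
  { adj    = λ u v → isZero u xor isZero v
  ; sym    = λ u v → xor-comm (isZero u) (isZero v)
  ; irrefl = λ u → xor-self (isZero u)
  }

module Submission where

-- The star on Fin (suc m) has centre zero and leaves suc i; an orientation D of it is
-- determined by its set o of out-leaves (arcs centre → leaf).  For f with centre value c
-- and leaf values x, a leaf in o is good (f(N⁺[v]) ≥ 1) iff it is positive, any other
-- leaf is good iff it and the centre are positive, and the centre is good iff
-- c + Σ_{i∈o} x_i ≥ 1 (star-goodCount).  As f(V) + n = 2·#positives (weight-count),
-- everything reduces to counting positive and good vertices.
--
-- Lower bounds: a good leaf is positive, so a MODF with p positive vertices has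
-- n ≤ 2(p+1) in every orientation (star-MODF-bound), and n ≤ 2p in the in-star, where a
-- MODF needs a positive centre (inStar-MODF-bound).
-- Constructions: a negative centre pointing exactly to k ≥ 2 positive leaves makes them
-- and the centre good (spread-witness).  In any orientation, a positive centre and k
-- positive leaves taken greedily among the out-leaves keep the centre good when |o| ≤ 2k
-- (balanced-witness); otherwise k positive out-leaves and a negative centre still give k
-- good vertices (outward-witness).

open import Defs
open import Data.Nat using (ℕ; _≤_; _%_)
open import Data.Integer using (+_; -_)
open import Data.Product using (_×_)
open import Relation.Binary.PropositionalEquality using (_≡_)

open import Data.Nat as ℕ using (zero; suc; _+_; _∸_; _⊓_; z≤n; s≤s; ⌊_/2⌋)
import Data.Nat.Properties as ℕP
open import Data.Nat.DivMod using (_/_; m≡m%n+[m/n]*n)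
open import Data.Integer as ℤ using (ℤ; +≤+)
import Data.Integer.Properties as ℤP
open import Algebra.Properties.AbelianGroup ℤP.+-0-abelianGroup using (∙-cancelʳ; //-rightDividesʳ)
import Algebra.Properties.CommutativeSemigroup as CommSemigroupProperties
open import Data.Fin using (Fin; zero; suc)
open import Data.Bool using (Bool; true; false; _∨_; _∧_; not; if_then_else_)
open import Data.Bool.Properties using (∨-conicalˡ)
open import Data.Vec.Functional using (_∷_; tail)
open import Data.Product using (Σ; _,_; proj₁; proj₂)
open import Data.Sum using (inj₁; inj₂)
open import Function using (_∘_)
open import Relation.Nullary using (yes; no)
open import Relation.Binary.PropositionalEquality as ≡
  using (refl; cong; cong₂; subst; subst₂; module ≡-Reasoning)

private
  module ℕCS = CommSemigroupProperties ℕP.+-commutativeSemigroup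
  module ℤCS = CommSemigroupProperties ℤP.+-commutativeSemigroup

ind : Bool → ℕ
ind b = if b then 1 else 0

ind≤1 : ∀ b → ind b ≤ 1
ind≤1 true  = s≤s z≤n
ind≤1 false = z≤n

ind-mono : ∀ {a b} → (a ≡ true → b ≡ true) → ind a ≤ ind b
ind-mono {true}  a⇒b rewrite a⇒b refl = s≤s z≤n
ind-mono {false} _   = z≤n

countFin-ext : ∀ {m} {p q : Fin m → Bool} → (∀ i → p i ≡ q i) → countFin p ≡ countFin q
countFin-ext {zero}  _  = refl
countFin-ext {suc m} eq = cong₂ _+_ (cong ind (eq zero)) (countFin-ext (eq ∘ suc))

sumFin-ext : ∀ {m} {g h : Fin m → ℤ} → (∀ i → g i ≡ h i) → sumFin g ≡ sumFin h
sumFin-ext {zero}  _  = refl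
sumFin-ext {suc m} eq = cong₂ ℤ._+_ (eq zero) (sumFin-ext (eq ∘ suc))

sumFin-zero : ∀ {m} → sumFin {m} (λ _ → + 0) ≡ + 0
sumFin-zero {zero}  = refl
sumFin-zero {suc m} = cong (λ s → + 0 ℤ.+ s) (sumFin-zero {m})

countFin-false : ∀ {m} → countFin {m} (λ _ → false) ≡ 0
countFin-false {zero}  = refl
countFin-false {suc m} = countFin-false {m}

countFin-≤ : ∀ {m} (p : Fin m → Bool) → countFin p ≤ m
countFin-≤ {zero}  _ = z≤n
countFin-≤ {suc m} p = ℕP.+-mono-≤ (ind≤1 (p zero)) (countFin-≤ (tail p))

countFin-mono : ∀ {m} {p q : Fin m → Bool} → (∀ i → p i ≡ true → q i ≡ true) →
                countFin p ≤ countFin q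
countFin-mono {zero}  _   = z≤n
countFin-mono {suc m} p⇒q = ℕP.+-mono-≤ (ind-mono (p⇒q zero)) (countFin-mono (p⇒q ∘ suc))

subsetOfSize : ∀ m k → k ≤ m → Σ (Fin m → Bool) λ x → countFin x ≡ k
subsetOfSize zero    zero    z≤n      = (λ ()) , refl
subsetOfSize (suc m) zero    z≤n      =
  let (x , |x|) = subsetOfSize m 0 z≤n in (false ∷ x) , |x|
subsetOfSize (suc m) (suc k) (s≤s le) =
  let (x , |x|) = subsetOfSize m k le in (true ∷ x) , cong suc |x|

hits misses : ∀ {m} → (Fin m → Bool) → (Fin m → Bool) → ℕ
hits   o x = countFin (λ i → o i ∧ x i)
misses o x = countFin (λ i → o i ∧ not (x i))

Greedy : ∀ m → (Fin m → Bool) → ℕ → Set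
Greedy m o k = Σ (Fin m → Bool) λ x →
  countFin x ≡ k × hits o x ≡ k ⊓ countFin o × misses o x ≡ countFin o ∸ k

-- Take elements of o first, and elements outside o only once o is exhausted.
greedy : ∀ m (o : Fin m → Bool) k → k ≤ m → Greedy m o k
greedy zero    o zero z≤n = (λ ()) , refl , refl , refl
greedy (suc m) o k    le  = step (o zero) (tail o) k le
  where
  step : ∀ a (o′ : Fin m → Bool) k → k ≤ suc m → Greedy (suc m) (a ∷ o′) k
  step true o′ (suc k) (s≤s le) =
    let (x , |x| , hit , miss) = greedy m o′ k le
    in (true ∷ x) , cong suc |x| , cong suc hit , miss
  step true o′ zero _ =
    let (x , |x| , hit , miss) = greedy m o′ 0 z≤n
    in (false ∷ x) , |x| , hit , cong suc miss
  step false o′ k le with ℕP.m≤n⇒m<n∨m≡n le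
  ... | inj₁ (s≤s k≤m) =
    let (x , |x| , hit , miss) = greedy m o′ k k≤m
    in (false ∷ x) , |x| , hit , miss
  ... | inj₂ refl =
    let (x , |x| , hit , miss) = greedy m o′ m ℕP.≤-refl
    in (true ∷ x) , cong suc |x| , ≡.trans hit allHit , ≡.trans miss noMiss
    where
    -- Here every element is taken, so o′ is hit completely.
    |o′|≤m : countFin o′ ≤ m
    |o′|≤m = countFin-≤ o′
    allHit : m ⊓ countFin o′ ≡ suc m ⊓ countFin o′
    allHit = ≡.trans (ℕP.m≥n⇒m⊓n≡n |o′|≤m)
                     (≡.sym (ℕP.m≥n⇒m⊓n≡n (ℕP.m≤n⇒m≤1+n |o′|≤m)))
    noMiss : countFin o′ ∸ m ≡ countFin o′ ∸ suc m
    noMiss = ≡.trans (ℕP.m≤n⇒m∸n≡0 |o′|≤m)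
                     (≡.sym (ℕP.m≤n⇒m∸n≡0 (ℕP.m≤n⇒m≤1+n |o′|≤m)))

-- If |o| ≤ 2k, a greedy k-subset misses no more elements of o than it hits.
greedy-balanced : ∀ b k → b ≤ k + k → b ∸ k ≤ k ⊓ b
greedy-balanced b k b≤2k with ℕP.≤-total k b
... | inj₁ k≤b = subst (b ∸ k ≤_) (≡.sym (ℕP.m≤n⇒m⊓n≡m k≤b))
                   (subst (b ∸ k ≤_) (ℕP.m+n∸n≡m k k) (ℕP.∸-monoˡ-≤ k b≤2k))
... | inj₂ b≤k = subst (_≤ k ⊓ b) (≡.sym (ℕP.m≤n⇒m∸n≡0 b≤k)) z≤n

⌊1+n+n/2⌋≡n : ∀ n → ⌊ suc (n + n) /2⌋ ≡ n
⌊1+n+n/2⌋≡n zero    = refl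
⌊1+n+n/2⌋≡n (suc n) = cong suc (≡.trans (cong ⌊_/2⌋ (ℕP.+-suc n n)) (⌊1+n+n/2⌋≡n n))

half-≤ : ∀ {a b} → a + a ≤ suc (b + b) → a ≤ b
half-≤ {a} {b} h =
  subst₂ _≤_ (≡.sym (ℕP.n≡⌊n+n/2⌋ a)) (⌊1+n+n/2⌋≡n b) (ℕP.⌊n/2⌋-mono h)

half-< : ∀ {a b} → suc (a + a) ≤ b + b → suc a ≤ b
half-< {a} {b} h =
  subst₂ _≤_ (cong suc (≡.sym (ℕP.n≡⌊n+n/2⌋ a))) (≡.sym (ℕP.n≡⌈n+n/2⌉ b))
             (ℕP.⌈n/2⌉-mono h)

double-suc : ∀ a → suc a + suc a ≡ suc (suc (a + a))
double-suc a = cong suc (ℕP.+-suc a a)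

halves : ∀ n → n ≡ n % 2 + (n / 2 + n / 2)
halves n = ≡.trans (m≡m%n+[m/n]*n n 2) (cong (λ t → n % 2 + t) twice)
  where
  twice : n / 2 ℕ.* 2 ≡ n / 2 + n / 2
  twice = ≡.trans (ℕP.*-comm (n / 2) 2) (cong (λ t → n / 2 + t) (ℕP.+-identityʳ (n / 2)))

val+1 : ∀ b → val b ℤ.+ + 1 ≡ + (ind b + ind b)
val+1 true  = refl
val+1 false = refl

weight-count : ∀ {n} (f : SignFun n) → weight f ℤ.+ + n ≡ + (countFin f + countFin f)
weight-count {zero}  f = refl
weight-count {suc n} f = begin
  (val (f zero) ℤ.+ weight (tail f)) ℤ.+ (+ 1 ℤ.+ + n)
    ≡⟨ ℤCS.interchange (val (f zero)) (weight (tail f)) (+ 1) (+ n) ⟩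
  (val (f zero) ℤ.+ + 1) ℤ.+ (weight (tail f) ℤ.+ + n)
    ≡⟨ cong₂ ℤ._+_ (val+1 (f zero)) (weight-count (tail f)) ⟩
  + ((ι + ι) + (c + c))
    ≡⟨ cong +_ (ℕCS.interchange ι ι c c) ⟩
  + ((ι + c) + (ι + c))
    ∎
  where
  open ≡-Reasoning
  ι = ind (f zero)
  c = countFin (tail f)

+-cancelʳ-≤ : ∀ a b c → a ℤ.+ c ℤ.≤ b ℤ.+ c → a ℤ.≤ b
+-cancelʳ-≤ a b c le =
  subst₂ ℤ._≤_ (//-rightDividesʳ c a) (//-rightDividesʳ c b) (ℤP.+-monoˡ-≤ (- c) le)

weight-≥ : ∀ {n} (f : SignFun n) {w M} → w ℤ.+ + n ≡ + M →
           M ≤ countFin f + countFin f → w ℤ.≤ weight f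
weight-≥ {n} f {w} e le =
  +-cancelʳ-≤ w (weight f) (+ n) (subst₂ ℤ._≤_ (≡.sym e) (≡.sym (weight-count f)) (+≤+ le))

weight-≡ : ∀ {n} (f : SignFun n) {w M} → w ℤ.+ + n ≡ + M →
           countFin f + countFin f ≡ M → weight f ≡ w
weight-≡ {n} f {w} e eq =
  ∙-cancelʳ (+ n) (weight f) w (≡.trans (weight-count f) (≡.trans (cong +_ eq) (≡.sym e)))

Witness : ∀ {n} → Digraph n → ℕ → ℕ → Set
Witness {n} D p g = Σ (SignFun n) λ f → countFin f ≡ p × g ≤ countFin (goodVertex D f)

witness-MODF : ∀ {n} (D : Digraph n) {p g w} → Witness D p g → n ≤ g + g →
               w ℤ.+ + n ≡ + (p + p) → Σ (SignFun n) λ f → IsMODF D f × weight f ≡ w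
witness-MODF D {p} {g} (f , |f| , g≤good) n≤2g e =
  f , ℕP.≤-trans n≤2g (subst (g + g ≤_) twice (ℕP.+-mono-≤ g≤good g≤good)) ,
  weight-≡ f e (cong (λ q → q + q) |f|)
  where
  good = countFin (goodVertex D f)
  twice : good + good ≡ 2 ℕ.* good
  twice = cong (λ t → good + t) (≡.sym (ℕP.+-identityʳ good))

maxDom-intro : ∀ {n} (G : Graph n) (w : ℤ) (D₀ : Digraph n) → IsOrientation G D₀ →
               IsGammaMaj D₀ w →
               (∀ D → IsOrientation G D → Σ (SignFun n) λ f → IsMODF D f × weight f ℤ.≤ w) →
               IsMaxDomMaj G w
maxDom-intro G w D₀ ori₀ γ₀ small = (D₀ , ori₀ , γ₀) , bound
  where
  bound : ∀ D w′ → IsOrientation G D → IsGammaMaj D w′ → w′ ℤ.≤ w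
  bound D w′ ori (_ , minimal) =
    let (f , modf , f≤w) = small D ori in ℤP.≤-trans (minimal f modf) f≤w

minDom-intro : ∀ {n} (G : Graph n) (w : ℤ) (D₀ : Digraph n) → IsOrientation G D₀ →
               (Σ (SignFun n) λ f → IsMODF D₀ f × weight f ≡ w) →
               (∀ D → IsOrientation G D → ∀ f → IsMODF D f → w ℤ.≤ weight f) →
               IsMinDomMaj G w
minDom-intro G w D₀ ori₀ attained large =
  (D₀ , ori₀ , attained , large D₀ ori₀) ,
  λ D w′ ori ((f , modf , wf) , _) → subst (w ℤ.≤_) wf (large D ori f modf)

outLeaves : ∀ {m} → Digraph (suc m) → Fin m → Bool
outLeaves D i = D zero (suc i)

-- Σ_{i ∈ o} x_i: the centre's closed out-neighbourhood sum without the centre itself.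
outSum : ∀ {m} → (Fin m → Bool) → (Fin m → Bool) → ℤ
outSum o x = sumFin (λ i → if o i then val (x i) else + 0)

outSum-split : ∀ {m} (o x : Fin m → Bool) → outSum o x ℤ.+ + misses o x ≡ + hits o x
outSum-split {zero}  o x = refl
outSum-split {suc m} o x = step (o zero) (x zero) (outSum-split (tail o) (tail x))
  where
  S = outSum (tail o) (tail x)
  step : ∀ a b {mi hi} → S ℤ.+ + mi ≡ + hi →
         ((if a then val b else + 0) ℤ.+ S) ℤ.+ + (ind (a ∧ not b) + mi) ≡ + (ind (a ∧ b) + hi)
  step false b     {mi} e = ≡.trans (cong (ℤ._+ + mi) (ℤP.+-identityˡ S)) e
  step true  true  {mi} e = ≡.trans (ℤP.+-assoc (+ 1) S (+ mi)) (cong (λ s → + 1 ℤ.+ s) e)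
  step true  false {mi} e = begin
    (- (+ 1) ℤ.+ S) ℤ.+ + suc mi ≡⟨ cong (ℤ._+ + suc mi) (ℤP.+-comm (- (+ 1)) S) ⟩
    (S ℤ.+ - (+ 1)) ℤ.+ + suc mi ≡⟨ ℤP.+-assoc S (- (+ 1)) (+ suc mi) ⟩
    S ℤ.+ + mi                   ≡⟨ e ⟩
    + _                          ∎
    where open ≡-Reasoning

outSum-nonneg : ∀ {m} (o x : Fin m → Bool) → misses o x ≤ hits o x →
                outSum o x ≡ + (hits o x ∸ misses o x)
outSum-nonneg o x le = ∙-cancelʳ (+ misses o x) (outSum o x) (+ (hits o x ∸ misses o x))
  (≡.trans (outSum-split o x) (cong +_ (≡.sym (ℕP.m∸n+n≡m le))))

leafGood : Bool → Bool → Bool → Bool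
leafGood out x c = if out then x else x ∧ c

starGood : ∀ {m} → (Fin m → Bool) → Bool → (Fin m → Bool) → ℕ
starGood o c x =
  ind (+ 1 ℤ.≤ᵇ (val c ℤ.+ outSum o x)) + countFin (λ i → leafGood (o i) (x i) c)

leafGood-eval : ∀ out x c →
  (+ 1 ℤ.≤ᵇ (val x ℤ.+ ((if not out then val c else + 0) ℤ.+ + 0))) ≡ leafGood out x c
leafGood-eval true  true  _     = refl
leafGood-eval true  false _     = refl
leafGood-eval false true  true  = refl
leafGood-eval false true  false = refl
leafGood-eval false false true  = refl
leafGood-eval false false false = refl

leafGood-positive : ∀ out x c → leafGood out x c ≡ true → x ≡ true
leafGood-positive true  x     _ good = good
leafGood-positive false true  _ _    = refl
leafGood-positive false false _ ()

leafGood-centre+ : ∀ out x → leafGood out x true ≡ x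
leafGood-centre+ true  _     = refl
leafGood-centre+ false true  = refl
leafGood-centre+ false false = refl

leafGood-centre- : ∀ out x → leafGood out x false ≡ out ∧ x
leafGood-centre- true  _     = refl
leafGood-centre- false true  = refl
leafGood-centre- false false = refl

module StarOrientation {m : ℕ} (D : Digraph (suc m)) (ori : IsOrientation (star (suc m)) D) where

  no-loop : D zero zero ≡ false
  no-loop = ∨-conicalˡ (D zero zero) (D zero zero) (proj₁ (ori zero zero))

  no-leaf-arc : ∀ i j → D (suc i) (suc j) ≡ false
  no-leaf-arc i j =
    ∨-conicalˡ (D (suc i) (suc j)) (D (suc j) (suc i)) (proj₁ (ori (suc i) (suc j)))

  leaf-to-centre : ∀ i → D (suc i) zero ≡ not (outLeaves D i)
  leaf-to-centre i = exactlyOne _ _ (proj₁ (ori (suc i) zero)) (proj₂ (ori (suc i) zero))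
    where
    exactlyOne : ∀ a b → a ∨ b ≡ true → a ∧ b ≡ false → a ≡ not b
    exactlyOne true  false _ _ = refl
    exactlyOne false true  _ _ = refl

  star-goodCount : ∀ f → countFin (goodVertex D f) ≡ starGood (outLeaves D) (f zero) (tail f)
  star-goodCount f = cong₂ _+_ (cong ind centre) (countFin-ext leaf)
    where
    centre : (+ 1 ℤ.≤ᵇ closedOutSum D f zero)
           ≡ (+ 1 ℤ.≤ᵇ (val (f zero) ℤ.+ outSum (outLeaves D) (tail f)))
    centre = cong (λ s → + 1 ℤ.≤ᵇ (val (f zero) ℤ.+ s))
      (≡.trans (cong (λ b → (if b then val (f zero) else + 0) ℤ.+ outSum (outLeaves D) (tail f))
                     no-loop)
               (ℤP.+-identityˡ _))
    noLeafSum : ∀ i → sumFin (λ j → if D (suc i) (suc j) then val (f (suc j)) else + 0) ≡ + 0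
    noLeafSum i = ≡.trans
      (sumFin-ext (λ j → cong (λ b → if b then val (f (suc j)) else + 0) (no-leaf-arc i j)))
      (sumFin-zero {m})
    leaf : ∀ i → goodVertex D f (suc i) ≡ leafGood (outLeaves D i) (f (suc i)) (f zero)
    leaf i = ≡.trans
      (cong (λ s → + 1 ℤ.≤ᵇ (val (f (suc i)) ℤ.+ s))
        (cong₂ ℤ._+_ (cong (λ b → if b then val (f zero) else + 0) (leaf-to-centre i)) (noLeafSum i)))
      (leafGood-eval (outLeaves D i) (f (suc i)) (f zero))

open StarOrientation using (star-goodCount)

-- Only positive leaves can be good: at most one vertex more than the positive leaves is good.
starGood-≤ : ∀ {m} (o : Fin m → Bool) c x → starGood o c x ≤ suc (countFin x)
starGood-≤ o c x = ℕP.+-mono-≤ (ind≤1 _) (countFin-mono (λ i → leafGood-positive (o i) (x i) c))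

starGood-centre+ : ∀ {m} (o x : Fin m → Bool) {d} → outSum o x ≡ + d →
                   starGood o true x ≡ suc (countFin x)
starGood-centre+ o x e = cong₂ _+_ (cong (λ s → ind (+ 1 ℤ.≤ᵇ (+ 1 ℤ.+ s))) e)
                                   (countFin-ext (λ i → leafGood-centre+ (o i) (x i)))

star-MODF-bound : ∀ {m} (D : Digraph (suc m)) → IsOrientation (star (suc m)) D →
                  ∀ f → IsMODF D f → m ≤ suc (countFin f + countFin f)
star-MODF-bound {m} D ori f modf =
  ℕP.≤-pred (subst (suc m ≤_) twice (ℕP.≤-trans modf (ℕP.*-monoʳ-≤ 2 good≤)))
  where
  p = countFin f
  twice : 2 ℕ.* suc p ≡ suc (suc (p + p))
  twice = ≡.trans (cong (λ t → suc p + t) (ℕP.+-identityʳ (suc p))) (double-suc p)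
  good≤ : countFin (goodVertex D f) ≤ suc p
  good≤ = subst (_≤ suc p) (≡.sym (star-goodCount D ori f))
            (ℕP.≤-trans (starGood-≤ (outLeaves D) (f zero) (tail f))
                        (s≤s (ℕP.m≤n+m _ (ind (f zero)))))

starOrientation : ∀ {m} → (Fin m → Bool) → Digraph (suc m)
starOrientation o zero    zero    = false
starOrientation o zero    (suc i) = o i
starOrientation o (suc i) zero    = not (o i)
starOrientation o (suc i) (suc j) = false

starOrientation-isOrientation : ∀ {m} (o : Fin m → Bool) →
                                IsOrientation (star (suc m)) (starOrientation o)
starOrientation-isOrientation o zero    zero    = refl , refl
starOrientation-isOrientation o zero    (suc i) with o i
... | true  = refl , refl
... | false = refl , refl
starOrientation-isOrientation o (suc i) zero    with o i
... | true  = refl , refl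
... | false = refl , refl
starOrientation-isOrientation o (suc i) (suc j) = refl , refl

starOrientation-goodCount : ∀ {m} (o : Fin m → Bool) f →
  countFin (goodVertex (starOrientation o) f) ≡ starGood o (f zero) (tail f)
starOrientation-goodCount o = star-goodCount (starOrientation o) (starOrientation-isOrientation o)

-- The in-star: every leaf points to the centre.
inStar : ∀ {m} → Digraph (suc m)
inStar = starOrientation (λ _ → false)

inStar-witness : ∀ m k → k ≤ m → Witness (inStar {m}) (suc k) (suc k)
inStar-witness m k k≤m =
  let (x , |x|) = subsetOfSize m k k≤m
  in (true ∷ x) , cong suc |x| ,
     ℕP.≤-reflexive (≡.sym (≡.trans (starOrientation-goodCount _ (true ∷ x))
                                     (≡.trans (starGood-centre+ _ x (sumFin-zero {m})) (cong suc |x|))))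

-- A MODF of the in-star has a positive centre, and then only positive vertices are good.
inStar-MODF-bound : ∀ {m} f → IsMODF (inStar {m}) f → suc m ≤ countFin f + countFin f
inStar-MODF-bound {m} f modf =
  centre (f zero) (tail f) (subst (λ g → suc m ≤ 2 ℕ.* g) (starOrientation-goodCount _ f) modf)
  where
  noneGood : ∀ x → starGood (λ _ → false) false x ≡ 0
  noneGood x = cong₂ _+_
    (cong (λ s → ind (+ 1 ℤ.≤ᵇ (- (+ 1) ℤ.+ s))) (sumFin-zero {m}))
    (≡.trans (countFin-ext (λ i → leafGood-centre- false (x i))) (countFin-false {m}))
  centre : ∀ c x → suc m ≤ 2 ℕ.* starGood (λ _ → false) c x →
           suc m ≤ (ind c + countFin x) + (ind c + countFin x)
  centre true  x le = subst (suc m ≤_) (cong (λ t → suc (countFin x) + t) (ℕP.+-identityʳ _))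
                        (subst (λ g → suc m ≤ 2 ℕ.* g) (starGood-centre+ _ x (sumFin-zero {m})) le)
  centre false x le with ℕP.≤-trans le (ℕP.≤-reflexive (cong (2 ℕ.*_) (noneGood x)))
  ... | ()

-- A negative centre pointing exactly to k ≥ 2 positive leaves: the centre and the
-- positive leaves are good.
spread-witness : ∀ m k → 2 ≤ k → k ≤ m →
                 Σ (Fin m → Bool) λ o → Witness (starOrientation o) k (suc k)
spread-witness m k 2≤k k≤m =
  let (x , |x|) = subsetOfSize m k k≤m
  in x , (false ∷ x) , |x| , ℕP.≤-reflexive (≡.sym (≡.trans (goodCount x |x|) (cong suc |x|)))
  where
  ∧-idem : ∀ b → b ∧ b ≡ b
  ∧-idem true  = refl
  ∧-idem false = refl
  outSum-self : ∀ {m} (x : Fin m → Bool) → outSum x x ≡ + countFin x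
  outSum-self {zero}  x = refl
  outSum-self {suc m} x = step (x zero) (outSum-self (tail x))
    where
    step : ∀ b {S c} → S ≡ + c → (if b then val b else + 0) ℤ.+ S ≡ + (ind b + c)
    step true  refl = refl
    step false refl = refl
  centreGood : ∀ {c} → 2 ≤ c → ind (+ 1 ℤ.≤ᵇ (- (+ 1) ℤ.+ + c)) ≡ 1
  centreGood (s≤s (s≤s _)) = refl
  goodCount : ∀ x → countFin x ≡ k →
              countFin (goodVertex (starOrientation x) (false ∷ x)) ≡ suc (countFin x)
  goodCount x |x| = ≡.trans (starOrientation-goodCount x (false ∷ x))
    (cong₂ _+_ (≡.trans (cong (λ s → ind (+ 1 ℤ.≤ᵇ (- (+ 1) ℤ.+ s))) (outSum-self x))
                        (centreGood (subst (2 ≤_) (≡.sym |x|) 2≤k)))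
               (countFin-ext (λ i → ≡.trans (leafGood-centre- (x i) (x i)) (∧-idem (x i)))))

-- In any orientation with |o| ≤ 2k: a positive centre and k positive leaves chosen
-- greedily among the out-leaves make exactly the positive vertices good.
balanced-witness : ∀ {m} (D : Digraph (suc m)) → IsOrientation (star (suc m)) D →
                   ∀ k → k ≤ m → countFin (outLeaves D) ≤ k + k → Witness D (suc k) (suc k)
balanced-witness {m} D ori k k≤m |o|≤2k =
  let (x , |x| , hit , miss) = greedy m (outLeaves D) k k≤m
      balanced = subst₂ _≤_ (≡.sym miss) (≡.sym hit)
                   (greedy-balanced (countFin (outLeaves D)) k |o|≤2k)
      centre+  = starGood-centre+ (outLeaves D) x (outSum-nonneg (outLeaves D) x balanced)
  in (true ∷ x) , cong suc |x| ,
     ℕP.≤-reflexive (≡.sym (≡.trans (star-goodCount D ori (true ∷ x))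
                                     (≡.trans centre+ (cong suc |x|))))

-- In any orientation with k ≤ |o|: a negative centre and k positive out-leaves make
-- these k leaves good.
outward-witness : ∀ {m} (D : Digraph (suc m)) → IsOrientation (star (suc m)) D →
                  ∀ k → k ≤ m → k ≤ countFin (outLeaves D) → Witness D k k
outward-witness {m} D ori k k≤m k≤|o| =
  let (x , |x| , hit , _) = greedy m (outLeaves D) k k≤m
      goodLeaves = ≡.trans (countFin-ext (λ i → leafGood-centre- (outLeaves D i) (x i)))
                           (≡.trans hit (ℕP.m≤n⇒m⊓n≡m k≤|o|))
  in (false ∷ x) , |x| ,
     subst (k ≤_) (≡.sym (star-goodCount D ori (false ∷ x)))
       (subst (_≤ starGood (outLeaves D) false x) goodLeaves (ℕP.m≤n+m _ _))

maxDom-even : ∀ j → IsMaxDomMaj (star (suc (suc (j + j)))) (+ 0)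
maxDom-even j =
  maxDom-intro (star n) (+ 0) inStar (starOrientation-isOrientation _)
    (attain inStar (inStar-witness m j j≤m) , λ f modf → weight-≥ f refl (inStar-MODF-bound f modf))
    small
  where
  m = suc (j + j)
  n = suc m
  j≤m : j ≤ m
  j≤m = ℕP.m≤n⇒m≤1+n (ℕP.m≤m+n j j)
  attain : ∀ D → Witness D (suc j) (suc j) → Σ (SignFun n) λ f → IsMODF D f × weight f ≡ + 0
  attain D w = witness-MODF D w (ℕP.≤-reflexive (≡.sym (double-suc j)))
                                (cong +_ (≡.sym (double-suc j)))
  small : ∀ D → IsOrientation (star n) D → Σ (SignFun n) λ f → IsMODF D f × weight f ℤ.≤ + 0
  small D ori with countFin (outLeaves D) ℕ.≤? j + j
  ... | yes |o|≤2j = let (f , modf , wf) = attain D (balanced-witness D ori j j≤m |o|≤2j)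
                     in f , modf , ℤP.≤-reflexive wf
  ... | no  |o|>2j = let j<|o| = ℕP.≤-trans (s≤s (ℕP.m≤m+n j j)) (ℕP.≰⇒> |o|>2j)
                         (f , modf , wf) = attain D (outward-witness D ori (suc j) (s≤s (ℕP.m≤m+n j j))
                                                                     j<|o|)
                     in f , modf , ℤP.≤-reflexive wf

maxDom-odd : ∀ k → IsMaxDomMaj (star (suc (k + k))) (+ 1)
maxDom-odd k =
  maxDom-intro (star n) (+ 1) inStar (starOrientation-isOrientation _)
    (attain inStar (inStar-witness m k k≤m) , λ f modf → weight-≥ f refl (atLeast f modf))
    small
  where
  m = k + k
  n = suc m
  k≤m : k ≤ m
  k≤m = ℕP.m≤m+n k k
  attain : ∀ D → Witness D (suc k) (suc k) → Σ (SignFun n) λ f → IsMODF D f × weight f ≡ + 1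
  attain D w = witness-MODF D w
                 (ℕP.≤-trans (ℕP.n≤1+n n) (ℕP.≤-reflexive (≡.sym (double-suc k))))
                 (cong +_ (≡.sym (double-suc k)))
  atLeast : ∀ f → IsMODF (inStar {m}) f → suc (suc (k + k)) ≤ countFin f + countFin f
  atLeast f modf = let k<|f| = half-< {k} {countFin f} (inStar-MODF-bound f modf)
                   in subst (_≤ countFin f + countFin f) (double-suc k) (ℕP.+-mono-≤ k<|f| k<|f|)
  small : ∀ D → IsOrientation (star n) D → Σ (SignFun n) λ f → IsMODF D f × weight f ℤ.≤ + 1
  small D ori = let (f , modf , wf) = attain D (balanced-witness D ori k k≤m (countFin-≤ _))
                in f , modf , ℤP.≤-reflexive wf

minDom-even : ∀ J → 5 ≤ suc (suc (J + J)) → IsMinDomMaj (star (suc (suc (J + J)))) (- (+ 2))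
minDom-even J 5≤n =
  let (o , w) = spread-witness m J (half-< (ℕP.≤-pred (ℕP.≤-pred 5≤n)))
                                   (ℕP.m≤n⇒m≤1+n (ℕP.m≤m+n J J))
  in minDom-intro (star (suc m)) _ (starOrientation o) (starOrientation-isOrientation o)
       (witness-MODF (starOrientation o) w (ℕP.≤-reflexive (≡.sym (double-suc J))) refl)
       (λ D ori f modf → weight-≥ f refl (ℕP.≤-pred (star-MODF-bound D ori f modf)))
  where
  m = suc (J + J)

minDom-odd : ∀ K → 5 ≤ suc (K + K) → IsMinDomMaj (star (suc (K + K))) (- (+ 1))
minDom-odd K 5≤n =
  let (o , w) = spread-witness m K (half-≤ (ℕP.m≤n⇒m≤1+n (ℕP.≤-pred 5≤n))) (ℕP.m≤m+n K K)
  in minDom-intro (star (suc m)) _ (starOrientation o) (starOrientation-isOrientation o)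
       (witness-MODF (starOrientation o) w
         (ℕP.≤-trans (ℕP.n≤1+n _) (ℕP.≤-reflexive (≡.sym (double-suc K)))) refl)
       (λ D ori f modf → weight-≥ f refl (atLeast D ori f modf))
  where
  m = K + K
  atLeast : ∀ D → IsOrientation (star (suc m)) D → ∀ f → IsMODF D f →
            K + K ≤ countFin f + countFin f
  atLeast D ori f modf = let K≤|f| = half-≤ {K} {countFin f} (star-MODF-bound D ori f modf)
                         in ℕP.+-mono-≤ K≤|f| K≤|f|

even-elim : (P : ℕ → Set) → (∀ j → P (suc (suc (j + j)))) →
            ∀ n → 2 ≤ n → n % 2 ≡ 0 → P n
even-elim P p n 2≤n e = byHalf (n / 2) (≡.trans (halves n) (cong (_+ (n / 2 + n / 2)) e))
  where
  byHalf : ∀ h → n ≡ h + h → P n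
  byHalf zero    n≡0 with subst (2 ≤_) n≡0 2≤n
  ... | ()
  byHalf (suc j) n≡  = subst P (≡.sym (≡.trans n≡ (double-suc j))) (p j)

odd-elim : (P : ℕ → Set) → (∀ k → P (suc (k + k))) → ∀ n → n % 2 ≡ 1 → P n
odd-elim P p n e = subst P (≡.sym (≡.trans (halves n) (cong (_+ (n / 2 + n / 2)) e))) (p (n / 2))

proposition4p4 : ∀ (n : ℕ) → 2 ≤ n →
    (n % 2 ≡ 0 → IsMaxDomMaj (star n) (+ 0)) ×
    (n % 2 ≡ 1 → IsMaxDomMaj (star n) (+ 1)) ×
    (5 ≤ n → n % 2 ≡ 0 → IsMinDomMaj (star n) (- (+ 2))) ×
    (5 ≤ n → n % 2 ≡ 1 → IsMinDomMaj (star n) (- (+ 1)))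
proposition4p4 n 2≤n =
  even-elim (λ n → IsMaxDomMaj (star n) (+ 0)) maxDom-even n 2≤n ,
  odd-elim (λ n → IsMaxDomMaj (star n) (+ 1)) maxDom-odd n ,
  (λ 5≤n e → even-elim (λ n → 5 ≤ n → IsMinDomMaj (star n) (- (+ 2))) minDom-even
                        n 2≤n e 5≤n) ,
  (λ 5≤n e → odd-elim (λ n → 5 ≤ n → IsMinDomMaj (star n) (- (+ 1))) minDom-odd n e 5≤n)
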